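{- Suppose that $M \models_{\gamma(h)} \phi$. Then there exists a finite set $\Gamma$ of first-order formulas such that $\Gamma ~|~ \gamma \vdash \phi$ is provable and such that $M \models_h \Gamma$.
   Context: Variables are split into parameter variables and team variables. Independence logic formulas are in negation normal form, are built from literals, atoms $\bar t_2\perp_{\bar t_1}\bar t_3$, $\wedge,\vee,\exists,\forall$, and contain no parameter variables. Entailment semantics $M\models_{\gamma(h)}\phi$ (for $\gamma$ first-order and $h$ a parameter assignment): - literal: all team-variable assignments $s$ with $M\models_{h\cup s}\gamma$ satisfy $\phi$. - independence atom: for $s,s'$ satisfying $\gamma$ under $h$ with $\bar t_1\langle s\rangle=\bar t_1\langle s'\rangle$, some $s''$ satisfying $\gamma$ under $h$ agrees with $s$ on $\bar t_1\bar t_2$ and with $s'$ on $\bar t_1\bar t_3$. - $\vee$: there exist $h'\supseteq h$ and $\gamma_1,\gamma_2$ with $M\models_{\gamma_i(h')}\psi_i$ and $M\models_{h'}\forall\bar v(\gamma\leftrightarrow\gamma_1\vee\gamma_2)$. - $\wedge$: both conjuncts. - $\exists x\psi$: there exist $h'\supseteq h$ and $\gamma'$ with $M\models_{\gamma'(h')}\psi$ and $M\models_{h'}\forall\bar v(\exists x\gamma'\leftrightarrow\exists x\gamma)$. - $\forall x\psi$: there exist $h'\supseteq h$ and $\gamma'$ with $M\models_{\gamma'(h')}\psi$ and $M\models_{h'}\forall\bar v(\gamma'\leftrightarrow\exists x\gamma)$. Proof system for sequents $\Gamma~|~\gamma\vdash\phi$. Axioms: - PS-lit: $\forall\bar v(\gamma\to\phi)~|~\gamma\vdash\phi$.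 - PS-ind: $\forall\bar v_1\bar v_2((\gamma(\bar v_1)\wedge\gamma(\bar v_2)\wedge\bar t_1(\bar v_1)=\bar t_1(\bar v_2))\to\exists\bar v_3(\gamma(\bar v_3)\wedge\bar t_1\bar t_2(\bar v_3)=\bar t_1\bar t_2(\bar v_1)\wedge\bar t_1\bar t_3(\bar v_3)=\bar t_1\bar t_3(\bar v_2)))~|~\gamma\vdash\bar t_2\perp_{\bar t_1}\bar t_3$. Rules: - PS-$\vee$: from $\Gamma_i~|~\gamma_i\vdash\phi_i$ infer $\Gamma_1,\Gamma_2,\forall\bar v(\gamma\leftrightarrow\gamma_1\vee\gamma_2)~|~\gamma\vdash\phi_1\vee\phi_2$. - PS-$\wedge$: from $\Gamma_i~|~\gamma\vdash\phi_i$ infer $\Gamma_1,\Gamma_2~|~\gamma\vdash\phi_1\wedge\phi_2$. - PS-$\exists$: from $\Gamma~|~\gamma'\vdash\phi$ infer $\Gamma,\forall\bar v(\exists x\gamma'\leftrightarrow\exists x\gamma)~|~\gamma\vdash\exists x\phi$. - PS-$\forall$: from $\Gamma~|~\gamma'\vdash\phi$ infer $\Gamma,\forall\bar v(\gamma'\leftrightarrow\exists x\gamma)~|~\gamma\vdash\forall x\phi$. - PS-ent: replace $\Gamma$ by $\Gamma'$ with $\bigwedge\Gamma'\models\bigwedge\Gamma$. - PS-depar: from $\Gamma~|~\gamma\vdash\phi$ infer $\exists p\bigwedge\Gamma~|~\gamma\vdash\phi$ for a parameter $p$ not free in $\gamma$. - PS-split: from $\Gamma_1~|~\gamma\vdash\phi$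 and $\Gamma_2~|~\gamma\vdash\phi$ infer $(\bigwedge\Gamma_1)\vee(\bigwedge\Gamma_2)~|~\gamma\vdash\phi$. -}

module Defs where

open import Data.Nat using (ℕ; _+_; _*_; _≟_)
open import Data.Bool using (Bool; true; false)
open import Data.Empty using (⊥; ⊥-elim)
open import Data.Unit using (⊤)
open import Data.Product using (Σ; _×_; _,_)
open import Data.Sum using (_⊎_)
open import Data.List using (List; []; _∷_; _++_; map; filter; foldr)
open import Data.List.Membership.Propositional using (_∈_; _∉_)
open import Data.Vec using (Vec)
open import Relation.Nullary using (¬_)
open import Relation.Nullary.Decidable using (¬?)
open import Relation.Binary.PropositionalEquality using (_≡_)

record Signature : Set₁ where
  field
    Fun   : Set
    Rel   : Set
    funAr : Fun → ℕ
    relAr : Rel → ℕ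

-- Parameter variables and team variables are both named by natural
-- numbers; they are kept apart by the syntax (constructors 'par'/'var',
-- quantifiers 'allP'/'exP' versus 'allT'/'exT').

module FO (S : Signature) where
  open Signature S

  -- Terms whose parameter variables range over P.
  -- First-order terms: Term ℕ.  Parameter-free terms: Term ⊥.
  data Term (P : Set) : Set where
    par : P → Term P
    var : ℕ → Term P
    fn  : (f : Fun) → Vec (Term P) (funAr f) → Term P

  data Atom (P : Set) : Set where
    eq  : Term P → Term P → Atom P
    rel : (R : Rel) → Vec (Term P) (relAr R) → Atom P

  data Form : Set where
    atom  : Atom ℕ → Form
    tt    : Form
    ff    : Form
    neg   : Form → Form
    and   : Form → Form → Form
    or    : Form → Form → Form
    imp   : Form → Form → Form
    allT  : ℕ → Form → Form
    exT   : ℕ → Form → Form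
    allP  : ℕ → Form → Form
    exP   : ℕ → Form → Form

  iff : Form → Form → Form
  iff a b = and (imp a b) (imp b a)

  record Literal : Set where
    constructor literal
    field
      positive : Bool
      theAtom  : Atom ⊥

  -- Independence logic formulas in negation normal form, with no
  -- parameter variables.  ind t₁ t₂ t₃ is the atom  t̄₂ ⊥_{t̄₁} t̄₃.
  data IL : Set where
    lit : Literal → IL
    ind : List (Term ⊥) → List (Term ⊥) → List (Term ⊥) → IL
    and : IL → IL → IL
    or  : IL → IL → IL
    ex  : ℕ → IL → IL
    all : ℕ → IL → IL

  mutual
    mapT : {P Q : Set} → (P → Q) → (ℕ → ℕ) → Term P → Term Q
    mapT g ρ (par p)   = par (g p)
    mapT g ρ (var x)   = var (ρ x)
    mapT g ρ (fn f ts) = fn f (mapTs g ρ ts)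

    mapTs : {P Q : Set} {n : ℕ} → (P → Q) → (ℕ → ℕ) → Vec (Term P) n → Vec (Term Q) n
    mapTs g ρ Vec.[]       = Vec.[]
    mapTs g ρ (t Vec.∷ ts) = mapT g ρ t Vec.∷ mapTs g ρ ts

  mapA : {P Q : Set} → (P → Q) → (ℕ → ℕ) → Atom P → Atom Q
  mapA g ρ (eq t u)   = eq (mapT g ρ t) (mapT g ρ u)
  mapA g ρ (rel R ts) = rel R (mapTs g ρ ts)

  emb : Term ⊥ → Term ℕ
  emb = mapT ⊥-elim (λ x → x)

  renF : (ℕ → ℕ) → Form → Form
  renF ρ (atom a)   = atom (mapA (λ p → p) ρ a)
  renF ρ tt         = tt
  renF ρ ff         = ff
  renF ρ (neg a)    = neg (renF ρ a)
  renF ρ (and a b)  = and (renF ρ a) (renF ρ b)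
  renF ρ (or a b)   = or (renF ρ a) (renF ρ b)
  renF ρ (imp a b)  = imp (renF ρ a) (renF ρ b)
  renF ρ (allT x a) = allT (ρ x) (renF ρ a)
  renF ρ (exT x a)  = exT (ρ x) (renF ρ a)
  renF ρ (allP p a) = allP p (renF ρ a)
  renF ρ (exP p a)  = exP p (renF ρ a)

  litF : Literal → Form
  litF (literal true a)  = atom (mapA ⊥-elim (λ x → x) a)
  litF (literal false a) = neg (atom (mapA ⊥-elim (λ x → x) a))

  remove : ℕ → List ℕ → List ℕ
  remove x = filter (λ y → ¬? (y ≟ x))

  mutual
    fvTerm : {P : Set} → Term P → List ℕ
    fvTerm (par p)   = []
    fvTerm (var x)   = x ∷ []
    fvTerm (fn f ts) = fvTerms ts

    fvTerms : {P : Set} {n : ℕ} → Vec (Term P) n → List ℕ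
    fvTerms Vec.[]       = []
    fvTerms (t Vec.∷ ts) = fvTerm t ++ fvTerms ts

  mutual
    fpTerm : Term ℕ → List ℕ
    fpTerm (par p)   = p ∷ []
    fpTerm (var x)   = []
    fpTerm (fn f ts) = fpTerms ts

    fpTerms : {n : ℕ} → Vec (Term ℕ) n → List ℕ
    fpTerms Vec.[]       = []
    fpTerms (t Vec.∷ ts) = fpTerm t ++ fpTerms ts

  fvAtom : {P : Set} → Atom P → List ℕ
  fvAtom (eq t u)   = fvTerm t ++ fvTerm u
  fvAtom (rel R ts) = fvTerms ts

  fpAtom : Atom ℕ → List ℕ
  fpAtom (eq t u)   = fpTerm t ++ fpTerm u
  fpAtom (rel R ts) = fpTerms ts

  fvT : Form → List ℕ
  fvT (atom a)   = fvAtom a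
  fvT tt         = []
  fvT ff         = []
  fvT (neg a)    = fvT a
  fvT (and a b)  = fvT a ++ fvT b
  fvT (or a b)   = fvT a ++ fvT b
  fvT (imp a b)  = fvT a ++ fvT b
  fvT (allT x a) = remove x (fvT a)
  fvT (exT x a)  = remove x (fvT a)
  fvT (allP p a) = fvT a
  fvT (exP p a)  = fvT a

  fpP : Form → List ℕ
  fpP (atom a)   = fpAtom a
  fpP tt         = []
  fpP ff         = []
  fpP (neg a)    = fpP a
  fpP (and a b)  = fpP a ++ fpP b
  fpP (or a b)   = fpP a ++ fpP b
  fpP (imp a b)  = fpP a ++ fpP b
  fpP (allT x a) = fpP a
  fpP (exT x a)  = fpP a
  fpP (allP p a) = remove p (fpP a)
  fpP (exP p a)  = remove p (fpP a)

  allTs : List ℕ → Form → Form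
  allTs xs a = foldr allT a xs

  exTs : List ℕ → Form → Form
  exTs xs a = foldr exT a xs

  closeT : Form → Form
  closeT a = allTs (fvT a) a

  bigAnd : List Form → Form
  bigAnd = foldr and tt

  eqs : List (Term ℕ) → List (Term ℕ) → Form
  eqs (t ∷ ts) (u ∷ us) = and (atom (eq t u)) (eqs ts us)
  eqs _        _        = tt

  -- Three disjoint injective renamings of team variables, used to form
  -- the copies γ(v̄₁), γ(v̄₂), γ(v̄₃) (all variables are renamed, so no
  -- capture can occur).
  ρ₁ ρ₂ ρ₃ : ℕ → ℕ
  ρ₁ v = 3 * v
  ρ₂ v = 3 * v + 1
  ρ₃ v = 3 * v + 2

  concatFv : List (Term ⊥) → List ℕ
  concatFv = foldr (λ t vs → fvTerm t ++ vs) []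

  indAx : Form → List (Term ⊥) → List (Term ⊥) → List (Term ⊥) → Form
  indAx γ t₁ t₂ t₃ =
    allTs (map ρ₁ vs ++ map ρ₂ vs)
      (imp (and (renF ρ₁ γ) (and (renF ρ₂ γ) (eqs (r ρ₁ t₁) (r ρ₂ t₁))))
           (exTs (map ρ₃ vs)
             (and (renF ρ₃ γ)
               (and (eqs (r ρ₃ (t₁ ++ t₂)) (r ρ₁ (t₁ ++ t₂)))
                    (eqs (r ρ₃ (t₁ ++ t₃)) (r ρ₂ (t₁ ++ t₃)))))))
    where
      vs : List ℕ
      vs = fvT γ ++ concatFv (t₁ ++ t₂ ++ t₃)
      r : (ℕ → ℕ) → List (Term ⊥) → List (Term ℕ)
      r ρ = map (mapT ⊥-elim ρ)

  record Structure : Set₁ where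
    field
      D     : Set
      inhab : D
      funI  : (f : Fun) → Vec D (funAr f) → D
      relI  : (R : Rel) → Vec D (relAr R) → Set

  module _ (M : Structure) where
    open Structure M

    update : (ℕ → D) → ℕ → D → ℕ → D
    update g x d y with y ≟ x
    ... | Relation.Nullary.yes _ = d
    ... | Relation.Nullary.no _  = g y

    mutual
      evalT : {P : Set} → (P → D) → (ℕ → D) → Term P → D
      evalT hp s (par p)   = hp p
      evalT hp s (var x)   = s x
      evalT hp s (fn f ts) = funI f (evalTs hp s ts)

      evalTs : {P : Set} {n : ℕ} → (P → D) → (ℕ → D) → Vec (Term P) n → Vec D n
      evalTs hp s Vec.[]       = Vec.[]
      evalTs hp s (t Vec.∷ ts) = evalT hp s t Vec.∷ evalTs hp s ts

    satA : (ℕ → D) → (ℕ → D) → Atom ℕ → Set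
    satA hp s (eq t u)   = evalT hp s t ≡ evalT hp s u
    satA hp s (rel R ts) = relI R (evalTs hp s ts)

    -- sat a hp s :  M ⊨_{hp ∪ s} a   (hp values of parameters, s of team variables)
    sat : Form → (ℕ → D) → (ℕ → D) → Set
    sat (atom a)   hp s = satA hp s a
    sat tt         hp s = ⊤
    sat ff         hp s = ⊥
    sat (neg a)    hp s = ¬ sat a hp s
    sat (and a b)  hp s = sat a hp s × sat b hp s
    sat (or a b)   hp s = sat a hp s ⊎ sat b hp s
    sat (imp a b)  hp s = sat a hp s → sat b hp s
    sat (allT x a) hp s = (d : D) → sat a hp (update s x d)
    sat (exT x a)  hp s = Σ D λ d → sat a hp (update s x d)
    sat (allP p a) hp s = (d : D) → sat a (update hp p d) s
    sat (exP p a)  hp s = Σ D λ d → sat a (update hp p d) s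

    evs : List (Term ⊥) → (ℕ → D) → List D
    evs ts s = map (evalT ⊥-elim s) ts

    record PAssign : Set where
      field
        dom : List ℕ
        val : ℕ → D
    open PAssign public

    _⊑_ : PAssign → PAssign → Set
    h ⊑ h' = (p : ℕ) → p ∈ dom h → (p ∈ dom h') × (val h p ≡ val h' p)

    Covers : PAssign → Form → Set
    Covers h a = (p : ℕ) → p ∈ fpP a → p ∈ dom h

    -- M ⊨_h a  (a first-order formula, free team variables read universally)
    ⊨₁ : PAssign → Form → Set
    ⊨₁ h a = Covers h a × ((s : ℕ → D) → sat a (val h) s)

    ⊨Γ : PAssign → List Form → Set
    ⊨Γ h Γ = (a : Form) → a ∈ Γ → ⊨₁ h a

    -- M ⊨_{γ(h)} φ  (presupposing h is defined on the parameters of γ)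
    Sem : IL → Form → PAssign → Set
    Sem (lit l) γ h = Covers h γ ×
      ((s : ℕ → D) → sat γ (val h) s → sat (litF l) (val h) s)
    Sem (ind t₁ t₂ t₃) γ h = Covers h γ ×
      ((s s′ : ℕ → D) → sat γ (val h) s → sat γ (val h) s′ →
         evs t₁ s ≡ evs t₁ s′ →
         Σ (ℕ → D) λ s″ → sat γ (val h) s″ ×
           (evs (t₁ ++ t₂) s″ ≡ evs (t₁ ++ t₂) s) ×
           (evs (t₁ ++ t₃) s″ ≡ evs (t₁ ++ t₃) s′))
    Sem (and φ ψ) γ h = Covers h γ × Sem φ γ h × Sem ψ γ h
    Sem (or φ ψ) γ h = Covers h γ ×
      Σ PAssign λ h′ → h ⊑ h′ × Σ Form λ γ₁ → Σ Form λ γ₂ →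
        Sem φ γ₁ h′ × Sem ψ γ₂ h′ × ⊨₁ h′ (closeT (iff γ (or γ₁ γ₂)))
    Sem (ex x ψ) γ h = Covers h γ ×
      Σ PAssign λ h′ → h ⊑ h′ × Σ Form λ γ′ →
        Sem ψ γ′ h′ × ⊨₁ h′ (closeT (iff (exT x γ′) (exT x γ)))
    Sem (all x ψ) γ h = Covers h γ ×
      Σ PAssign λ h′ → h ⊑ h′ × Σ Form λ γ′ →
        Sem ψ γ′ h′ × ⊨₁ h′ (closeT (iff γ′ (exT x γ)))

  _⊨ᶜ_ : Form → Form → Set₁
  a ⊨ᶜ b = (N : Structure) (hp s : ℕ → Structure.D N) →
           sat N a hp s → sat N b hp s

  data Prov : List Form → Form → IL → Set₁ where
    ps-lit : (γ : Form) (l : Literal) →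
      Prov (closeT (imp γ (litF l)) ∷ []) γ (lit l)
    ps-ind : (γ : Form) (t₁ t₂ t₃ : List (Term ⊥)) →
      Prov (indAx γ t₁ t₂ t₃ ∷ []) γ (ind t₁ t₂ t₃)
    ps-or : ∀ {Γ₁ Γ₂ γ₁ γ₂ φ₁ φ₂} (γ : Form) →
      Prov Γ₁ γ₁ φ₁ → Prov Γ₂ γ₂ φ₂ →
      Prov (Γ₁ ++ Γ₂ ++ (closeT (iff γ (or γ₁ γ₂)) ∷ [])) γ (or φ₁ φ₂)
    ps-and : ∀ {Γ₁ Γ₂ γ φ₁ φ₂} →
      Prov Γ₁ γ φ₁ → Prov Γ₂ γ φ₂ → Prov (Γ₁ ++ Γ₂) γ (and φ₁ φ₂)
    ps-ex : ∀ {Γ γ′ φ} (γ : Form) (x : ℕ) →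
      Prov Γ γ′ φ →
      Prov (Γ ++ (closeT (iff (exT x γ′) (exT x γ)) ∷ [])) γ (ex x φ)
    ps-all : ∀ {Γ γ′ φ} (γ : Form) (x : ℕ) →
      Prov Γ γ′ φ →
      Prov (Γ ++ (closeT (iff γ′ (exT x γ)) ∷ [])) γ (all x φ)
    ps-ent : ∀ {Γ γ φ} (Γ′ : List Form) →
      bigAnd Γ′ ⊨ᶜ bigAnd Γ → Prov Γ γ φ → Prov Γ′ γ φ
    ps-depar : ∀ {Γ γ φ} (p : ℕ) → p ∉ fpP γ →
      Prov Γ γ φ → Prov (exP p (bigAnd Γ) ∷ []) γ φ
    ps-split : ∀ {Γ₁ Γ₂ γ φ} →
      Prov Γ₁ γ φ → Prov Γ₂ γ φ → Prov (or (bigAnd Γ₁) (bigAnd Γ₂) ∷ []) γ φ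

module Submission where

-- The proof is by induction on φ and mirrors the semantic clauses:
--   * literals and independence atoms: the first-order side condition of
--     the axiom PS-lit resp. PS-ind is true in M under h;
--   * ∧ : PS-∧ combines the two derivations;
--   * ∨, ∃, ∀ : the semantic clause supplies h′ ⊇ h and formulas γ′ (γ₁, γ₂)
--     for which induction and the rule give a context true under h′ only.
--     Parameter elimination then existentially quantifies (PS-depar) the
--     parameters of dom h′ outside dom h, one at a time, yielding a context
--     true under h itself.

open import Defs
open import Data.Bool using (true; false)
open import Data.Empty using (⊥; ⊥-elim)
open import Data.List using (List; []; _∷_; _++_; map; concatMap)
open import Data.List.Membership.Propositional using (_∈_; _∉_)
open import Data.List.Membership.Propositional.Properties using (∈-++⁺ˡ; ∈-++⁺ʳ; ∈-++⁻; ∈-filter⁺; ∈-filter⁻; ∈-map⁻)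
open import Data.Nat using (ℕ; _+_; _*_; _%_; _≟_)
open import Data.List.Membership.DecPropositional _≟_ using (_∈?_)
open import Data.List.Properties using (∷-injectiveˡ; ∷-injectiveʳ)
open import Data.List.Relation.Binary.Subset.Propositional using (_⊆_)
open import Data.List.Relation.Binary.Subset.Propositional.Properties using (⊆-reflexive; xs⊆xs++ys; xs⊆ys++xs; ++⁺ʳ; concatMap⁺)
open import Data.List.Relation.Unary.Any using (here; there)
open import Data.Nat.DivMod using ([m+kn]%n≡m%n)
open import Data.Nat.Properties using (+-comm; *-comm; +-identityʳ; +-cancelʳ-≡; *-cancelˡ-≡)
open import Data.Product using (Σ; _×_; _,_; proj₁; proj₂)
open import Data.Product.Function.NonDependent.Propositional using (_×-⇔_)
open import Data.Sum using (_⊎_; inj₁; inj₂; [_,_]′)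
open import Data.Sum.Function.Propositional using (_⊎-⇔_)
open import Data.Unit using (tt)
open import Data.Vec using (Vec)
open import Function using (_∘_; id)
open import Function.Bundles using (_⇔_; mk⇔; Equivalence)
open import Function.Construct.Composition using (_⇔-∘_)
open import Function.Definitions using (Injective)
open import Function.Related.TypeIsomorphisms using (→-cong-⇔; ¬-cong-⇔)
open import Relation.Nullary using (yes; no)
open import Relation.Nullary.Decidable using (¬?)
open import Relation.Binary.PropositionalEquality using (_≡_; _≢_; refl; sym; trans; cong; cong₂; subst)

open Equivalence using (to; from)

++-⊆ : {A : Set} {xs ys zs : List A} → xs ⊆ zs → ys ⊆ zs → xs ++ ys ⊆ zs
++-⊆ {xs = xs} xs⊆zs ys⊆zs i = [ xs⊆zs , ys⊆zs ]′ (∈-++⁻ xs i)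

module FreeParameters (S : Signature) where
  open FO S

  fpP-allTs : ∀ xs a → fpP (allTs xs a) ≡ fpP a
  fpP-allTs []       a = refl
  fpP-allTs (x ∷ xs) a = fpP-allTs xs a

  fpP-exTs : ∀ xs a → fpP (exTs xs a) ≡ fpP a
  fpP-exTs []       a = refl
  fpP-exTs (x ∷ xs) a = fpP-exTs xs a

  mutual
    fpTerm-ren : ∀ ρ (t : Term ℕ) → fpTerm (mapT (λ p → p) ρ t) ≡ fpTerm t
    fpTerm-ren ρ (par p)   = refl
    fpTerm-ren ρ (var x)   = refl
    fpTerm-ren ρ (fn f ts) = fpTerms-ren ρ ts

    fpTerms-ren : ∀ ρ {n} (ts : Vec (Term ℕ) n) → fpTerms (mapTs (λ p → p) ρ ts) ≡ fpTerms ts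
    fpTerms-ren ρ Vec.[]       = refl
    fpTerms-ren ρ (t Vec.∷ ts) = cong₂ _++_ (fpTerm-ren ρ t) (fpTerms-ren ρ ts)

  fpP-renF : ∀ ρ a → fpP (renF ρ a) ≡ fpP a
  fpP-renF ρ (atom (eq t u))   = cong₂ _++_ (fpTerm-ren ρ t) (fpTerm-ren ρ u)
  fpP-renF ρ (atom (rel R ts)) = fpTerms-ren ρ ts
  fpP-renF ρ tt                = refl
  fpP-renF ρ ff                = refl
  fpP-renF ρ (neg a)           = fpP-renF ρ a
  fpP-renF ρ (and a b)         = cong₂ _++_ (fpP-renF ρ a) (fpP-renF ρ b)
  fpP-renF ρ (or a b)          = cong₂ _++_ (fpP-renF ρ a) (fpP-renF ρ b)
  fpP-renF ρ (imp a b)         = cong₂ _++_ (fpP-renF ρ a) (fpP-renF ρ b)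
  fpP-renF ρ (allT x a)        = fpP-renF ρ a
  fpP-renF ρ (exT x a)         = fpP-renF ρ a
  fpP-renF ρ (allP p a)        = cong (remove p) (fpP-renF ρ a)
  fpP-renF ρ (exP p a)         = cong (remove p) (fpP-renF ρ a)

  mutual
    fpTerm-closed : ∀ ρ (t : Term ⊥) → fpTerm (mapT ⊥-elim ρ t) ≡ []
    fpTerm-closed ρ (par ())
    fpTerm-closed ρ (var x)   = refl
    fpTerm-closed ρ (fn f ts) = fpTerms-closed ρ ts

    fpTerms-closed : ∀ ρ {n} (ts : Vec (Term ⊥) n) → fpTerms (mapTs ⊥-elim ρ ts) ≡ []
    fpTerms-closed ρ Vec.[]       = refl
    fpTerms-closed ρ (t Vec.∷ ts) = cong₂ _++_ (fpTerm-closed ρ t) (fpTerms-closed ρ ts)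

  fpP-litF : ∀ l → fpP (litF l) ≡ []
  fpP-litF (literal true  (eq t u))   = cong₂ _++_ (fpTerm-closed id t) (fpTerm-closed id u)
  fpP-litF (literal true  (rel R ts)) = fpTerms-closed id ts
  fpP-litF (literal false (eq t u))   = cong₂ _++_ (fpTerm-closed id t) (fpTerm-closed id u)
  fpP-litF (literal false (rel R ts)) = fpTerms-closed id ts

  copy : (ℕ → ℕ) → List (Term ⊥) → List (Term ℕ)
  copy ρ = map (mapT ⊥-elim ρ)

  fpP-eqs : ∀ ρ ρ′ (ts us : List (Term ⊥)) → fpP (eqs (copy ρ ts) (copy ρ′ us)) ≡ []
  fpP-eqs ρ ρ′ []       us       = refl
  fpP-eqs ρ ρ′ (t ∷ ts) []       = refl
  fpP-eqs ρ ρ′ (t ∷ ts) (u ∷ us) =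
    cong₂ _++_ (cong₂ _++_ (fpTerm-closed ρ t) (fpTerm-closed ρ′ u)) (fpP-eqs ρ ρ′ ts us)

  concatFv≡concatMap : ∀ ts → concatFv ts ≡ concatMap fvTerm ts
  concatFv≡concatMap []       = refl
  concatFv≡concatMap (t ∷ ts) = cong (fvTerm t ++_) (concatFv≡concatMap ts)

  concatFv-mono : {ts us : List (Term ⊥)} → ts ⊆ us → concatFv ts ⊆ concatFv us
  concatFv-mono {ts} {us} ts⊆us rewrite concatFv≡concatMap ts | concatFv≡concatMap us =
    concatMap⁺ fvTerm ts⊆us

  -- The three copies v̄₁, v̄₂, v̄₃ of the team variables used in PS-ind are
  -- each injective and the third is disjoint from the first two, because
  -- they are the residue classes 0, 1, 2 modulo 3.
  residue : ∀ v i → (3 * v + i) % 3 ≡ i % 3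
  residue v i = trans (cong (_% 3) (trans (+-comm (3 * v) i) (cong (i +_) (*-comm 3 v))))
                      ([m+kn]%n≡m%n i v 3)

  ρ₁-injective : Injective _≡_ _≡_ ρ₁
  ρ₁-injective {v} {w} = *-cancelˡ-≡ v w 3

  ρ₂-injective : Injective _≡_ _≡_ ρ₂
  ρ₂-injective {v} {w} e = *-cancelˡ-≡ v w 3 (+-cancelʳ-≡ 1 (3 * v) (3 * w) e)

  ρ₃-injective : Injective _≡_ _≡_ ρ₃
  ρ₃-injective {v} {w} e = *-cancelˡ-≡ v w 3 (+-cancelʳ-≡ 2 (3 * v) (3 * w) e)

  ρ₁≢ρ₃ : ∀ v w → ρ₁ v ≢ ρ₃ w
  ρ₁≢ρ₃ v w e with trans (sym (residue v 0)) (trans (cong (_% 3) (trans (+-identityʳ (3 * v)) e)) (residue w 2))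
  ... | ()

  ρ₂≢ρ₃ : ∀ v w → ρ₂ v ≢ ρ₃ w
  ρ₂≢ρ₃ v w e with trans (sym (residue v 1)) (trans (cong (_% 3) e) (residue w 2))
  ... | ()

  -- The pieces of the PS-ind formula  ∀v̄₁v̄₂(indHyp → ∃v̄₃ indConcl),
  -- exactly as in the definition of indAx.
  indVars : Form → List (Term ⊥) → List (Term ⊥) → List (Term ⊥) → List ℕ
  indVars γ t₁ t₂ t₃ = fvT γ ++ concatFv (t₁ ++ t₂ ++ t₃)

  indHyp : Form → List (Term ⊥) → Form
  indHyp γ t₁ = and (renF ρ₁ γ) (and (renF ρ₂ γ) (eqs (copy ρ₁ t₁) (copy ρ₂ t₁)))

  indConcl : Form → List (Term ⊥) → List (Term ⊥) → List (Term ⊥) → Form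
  indConcl γ t₁ t₂ t₃ =
    and (renF ρ₃ γ) (and (eqs (copy ρ₃ (t₁ ++ t₂)) (copy ρ₁ (t₁ ++ t₂)))
                         (eqs (copy ρ₃ (t₁ ++ t₃)) (copy ρ₂ (t₁ ++ t₃))))

  indBody : Form → List (Term ⊥) → List (Term ⊥) → List (Term ⊥) → Form
  indBody γ t₁ t₂ t₃ = imp (indHyp γ t₁) (exTs (map ρ₃ (indVars γ t₁ t₂ t₃)) (indConcl γ t₁ t₂ t₃))

  indVars-⊇₁₂ : ∀ γ t₁ t₂ t₃ → concatFv (t₁ ++ t₂) ⊆ indVars γ t₁ t₂ t₃
  indVars-⊇₁₂ γ t₁ t₂ t₃ = xs⊆ys++xs _ (fvT γ) ∘ concatFv-mono (++⁺ʳ t₁ (xs⊆xs++ys t₂ t₃))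

  indVars-⊇₁₃ : ∀ γ t₁ t₂ t₃ → concatFv (t₁ ++ t₃) ⊆ indVars γ t₁ t₂ t₃
  indVars-⊇₁₃ γ t₁ t₂ t₃ = xs⊆ys++xs _ (fvT γ) ∘ concatFv-mono (++⁺ʳ t₁ (xs⊆ys++xs t₃ t₂))

  fpP-indBody : ∀ γ t₁ t₂ t₃ → fpP (indBody γ t₁ t₂ t₃) ⊆ fpP γ
  fpP-indBody γ t₁ t₂ t₃ =
    ++-⊆ (++-⊆ (copyγ ρ₁) (++-⊆ (copyγ ρ₂) (closed ρ₁ ρ₂ t₁)))
         (λ i → conclusion (subst (_ ∈_) (fpP-exTs (map ρ₃ (indVars γ t₁ t₂ t₃)) _) i))
    where
      copyγ : ∀ ρ → fpP (renF ρ γ) ⊆ fpP γ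
      copyγ ρ = ⊆-reflexive (fpP-renF ρ γ)
      closed : ∀ ρ ρ′ ts → fpP (eqs (copy ρ ts) (copy ρ′ ts)) ⊆ fpP γ
      closed ρ ρ′ ts i with () ← subst (_ ∈_) (fpP-eqs ρ ρ′ ts ts) i
      conclusion : fpP (indConcl γ t₁ t₂ t₃) ⊆ fpP γ
      conclusion = ++-⊆ (copyγ ρ₃) (++-⊆ (closed ρ₃ ρ₁ (t₁ ++ t₂)) (closed ρ₃ ρ₂ (t₁ ++ t₃)))

module Completeness (S : Signature) (M : FO.Structure S) where
  open FO S
  open Structure M
  open FreeParameters S

  Agree : List ℕ → (ℕ → D) → (ℕ → D) → Set
  Agree xs s s′ = ∀ y → y ∈ xs → s y ≡ s′ y

  agree-sym : ∀ {xs s s′} → Agree xs s s′ → Agree xs s′ s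
  agree-sym ag y i = sym (ag y i)

  agree-++ˡ : ∀ {xs ys s s′} → Agree (xs ++ ys) s s′ → Agree xs s s′
  agree-++ˡ ag y i = ag y (∈-++⁺ˡ i)

  agree-++ʳ : ∀ xs {ys s s′} → Agree (xs ++ ys) s s′ → Agree ys s s′
  agree-++ʳ xs ag y i = ag y (∈-++⁺ʳ xs i)

  agree-⊆ : ∀ {xs ys s s′} → xs ⊆ ys → Agree ys s s′ → Agree xs s s′
  agree-⊆ xs⊆ys ag y i = ag y (xs⊆ys i)

  update-hit : ∀ (s : ℕ → D) {x y} d → y ≡ x → update M s x d y ≡ d
  update-hit s {x} {y} d e with y ≟ x
  ... | yes _  = refl
  ... | no y≢x = ⊥-elim (y≢x e)

  update-miss : ∀ (s : ℕ → D) {x y} d → y ≢ x → update M s x d y ≡ s y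
  update-miss s {x} {y} d y≢x with y ≟ x
  ... | yes e = ⊥-elim (y≢x e)
  ... | no _  = refl

  agree-update : ∀ x xs s s′ d → Agree (remove x xs) s s′ →
                 Agree xs (update M s x d) (update M s′ x d)
  agree-update x xs s s′ d ag y i with y ≟ x
  ... | yes _  = refl
  ... | no y≢x = ag y (∈-filter⁺ (λ z → ¬? (z ≟ x)) i y≢x)

  agree-update-fresh : ∀ {xs s s′ p} d → p ∉ xs → Agree xs s s′ → Agree xs (update M s p d) s′
  agree-update-fresh {s = s} d p∉xs ag y i = trans (update-miss s d (λ { refl → p∉xs i })) (ag y i)

  agree-update-cons : ∀ {xs s s′} p → Agree xs s s′ → Agree (p ∷ xs) (update M s p (s′ p)) s′
  agree-update-cons {s = s} {s′} p ag y (here refl) = update-hit s {p} {p} (s′ p) refl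
  agree-update-cons p ag y (there i) with y ≟ p
  ... | yes refl = refl
  ... | no _     = ag y i

  mutual
    eval-coincidence : ∀ hp hp′ s s′ (t : Term ℕ) → Agree (fpTerm t) hp hp′ → Agree (fvTerm t) s s′ →
                       evalT M hp s t ≡ evalT M hp′ s′ t
    eval-coincidence hp hp′ s s′ (par p)   ap as = ap p (here refl)
    eval-coincidence hp hp′ s s′ (var x)   ap as = as x (here refl)
    eval-coincidence hp hp′ s s′ (fn f ts) ap as = cong (funI f) (evals-coincidence hp hp′ s s′ ts ap as)

    evals-coincidence : ∀ hp hp′ s s′ {n} (ts : Vec (Term ℕ) n) → Agree (fpTerms ts) hp hp′ →
                        Agree (fvTerms ts) s s′ → evalTs M hp s ts ≡ evalTs M hp′ s′ ts
    evals-coincidence hp hp′ s s′ Vec.[]       ap as = refl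
    evals-coincidence hp hp′ s s′ (t Vec.∷ ts) ap as =
      cong₂ Vec._∷_ (eval-coincidence hp hp′ s s′ t (agree-++ˡ ap) (agree-++ˡ as))
                    (evals-coincidence hp hp′ s s′ ts (agree-++ʳ (fpTerm t) ap) (agree-++ʳ (fvTerm t) as))

  sat-coincidence : ∀ a hp hp′ s s′ → Agree (fpP a) hp hp′ → Agree (fvT a) s s′ →
                    sat M a hp s → sat M a hp′ s′
  sat-coincidence (atom (eq t u)) hp hp′ s s′ ap as e =
    trans (sym (eval-coincidence hp hp′ s s′ t (agree-++ˡ ap) (agree-++ˡ as)))
          (trans e (eval-coincidence hp hp′ s s′ u (agree-++ʳ (fpTerm t) ap) (agree-++ʳ (fvTerm t) as)))
  sat-coincidence (atom (rel R ts)) hp hp′ s s′ ap as =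
    subst (relI R) (evals-coincidence hp hp′ s s′ ts ap as)
  sat-coincidence tt hp hp′ s s′ ap as x = x
  sat-coincidence ff hp hp′ s s′ ap as x = x
  sat-coincidence (neg a) hp hp′ s s′ ap as ¬x x =
    ¬x (sat-coincidence a hp′ hp s′ s (agree-sym ap) (agree-sym as) x)
  sat-coincidence (and a b) hp hp′ s s′ ap as (x , y) =
    sat-coincidence a hp hp′ s s′ (agree-++ˡ ap) (agree-++ˡ as) x ,
    sat-coincidence b hp hp′ s s′ (agree-++ʳ (fpP a) ap) (agree-++ʳ (fvT a) as) y
  sat-coincidence (or a b) hp hp′ s s′ ap as (inj₁ x) =
    inj₁ (sat-coincidence a hp hp′ s s′ (agree-++ˡ ap) (agree-++ˡ as) x)
  sat-coincidence (or a b) hp hp′ s s′ ap as (inj₂ y) =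
    inj₂ (sat-coincidence b hp hp′ s s′ (agree-++ʳ (fpP a) ap) (agree-++ʳ (fvT a) as) y)
  sat-coincidence (imp a b) hp hp′ s s′ ap as f x =
    sat-coincidence b hp hp′ s s′ (agree-++ʳ (fpP a) ap) (agree-++ʳ (fvT a) as)
      (f (sat-coincidence a hp′ hp s′ s (agree-sym (agree-++ˡ ap)) (agree-sym (agree-++ˡ as)) x))
  sat-coincidence (allT x a) hp hp′ s s′ ap as f d =
    sat-coincidence a hp hp′ _ _ ap (agree-update x (fvT a) s s′ d as) (f d)
  sat-coincidence (exT x a) hp hp′ s s′ ap as (d , y) =
    d , sat-coincidence a hp hp′ _ _ ap (agree-update x (fvT a) s s′ d as) y
  sat-coincidence (allP p a) hp hp′ s s′ ap as f d =
    sat-coincidence a _ _ s s′ (agree-update p (fpP a) hp hp′ d ap) as (f d)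
  sat-coincidence (exP p a) hp hp′ s s′ ap as (d , y) =
    d , sat-coincidence a _ _ s s′ (agree-update p (fpP a) hp hp′ d ap) as y

  sat-ext : ∀ a hp {s s′} → (∀ y → s y ≡ s′ y) → sat M a hp s ⇔ sat M a hp s′
  sat-ext a hp e = mk⇔ (sat-coincidence a hp hp _ _ (λ _ _ → refl) (λ y _ → e y))
                       (sat-coincidence a hp hp _ _ (λ _ _ → refl) (λ y _ → sym (e y)))

  mutual
    eval-team-coincidence : ∀ {P : Set} (hp : P → D) s s′ (t : Term P) → Agree (fvTerm t) s s′ →
                            evalT M hp s t ≡ evalT M hp s′ t
    eval-team-coincidence hp s s′ (par p)   as = refl
    eval-team-coincidence hp s s′ (var x)   as = as x (here refl)
    eval-team-coincidence hp s s′ (fn f ts) as = cong (funI f) (evals-team-coincidence hp s s′ ts as)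

    evals-team-coincidence : ∀ {P : Set} (hp : P → D) s s′ {n} (ts : Vec (Term P) n) →
                             Agree (fvTerms ts) s s′ → evalTs M hp s ts ≡ evalTs M hp s′ ts
    evals-team-coincidence hp s s′ Vec.[]       as = refl
    evals-team-coincidence hp s s′ (t Vec.∷ ts) as =
      cong₂ Vec._∷_ (eval-team-coincidence hp s s′ t (agree-++ˡ as))
                    (evals-team-coincidence hp s s′ ts (agree-++ʳ (fvTerm t) as))

  evs-coincidence : ∀ ts s s′ → Agree (concatFv ts) s s′ → evs M ts s ≡ evs M ts s′
  evs-coincidence []       s s′ as = refl
  evs-coincidence (t ∷ ts) s s′ as =
    cong₂ _∷_ (eval-team-coincidence ⊥-elim s s′ t (agree-++ˡ as))
              (evs-coincidence ts s s′ (agree-++ʳ (fvTerm t) as))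

  Π-⇔ : {A B : D → Set} → (∀ d → A d ⇔ B d) → ((d : D) → A d) ⇔ ((d : D) → B d)
  Π-⇔ e = mk⇔ (λ f d → to (e d) (f d)) (λ f d → from (e d) (f d))

  Σ-⇔ : {A B : D → Set} → (∀ d → A d ⇔ B d) → Σ D A ⇔ Σ D B
  Σ-⇔ e = mk⇔ (λ (d , x) → d , to (e d) x) (λ (d , x) → d , from (e d) x)

  module Renaming (ρ : ℕ → ℕ) (ρ-injective : Injective _≡_ _≡_ ρ) where
    mutual
      eval-renT : ∀ hp s (t : Term ℕ) → evalT M hp s (mapT (λ p → p) ρ t) ≡ evalT M hp (s ∘ ρ) t
      eval-renT hp s (par p)   = refl
      eval-renT hp s (var x)   = refl
      eval-renT hp s (fn f ts) = cong (funI f) (evals-renT hp s ts)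

      evals-renT : ∀ hp s {n} (ts : Vec (Term ℕ) n) →
                   evalTs M hp s (mapTs (λ p → p) ρ ts) ≡ evalTs M hp (s ∘ ρ) ts
      evals-renT hp s Vec.[]       = refl
      evals-renT hp s (t Vec.∷ ts) = cong₂ Vec._∷_ (eval-renT hp s t) (evals-renT hp s ts)

    update-renamed : ∀ (s : ℕ → D) x d y → update M s (ρ x) d (ρ y) ≡ update M (s ∘ ρ) x d y
    update-renamed s x d y with y ≟ x
    ... | yes y≡x = update-hit s d (cong ρ y≡x)
    ... | no y≢x  = update-miss s d (y≢x ∘ ρ-injective)

    sat-renF : ∀ a hp s → sat M (renF ρ a) hp s ⇔ sat M a hp (s ∘ ρ)
    sat-renF (atom (eq t u)) hp s =
      mk⇔ (λ e → trans (sym (eval-renT hp s t)) (trans e (eval-renT hp s u)))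
          (λ e → trans (eval-renT hp s t) (trans e (sym (eval-renT hp s u))))
    sat-renF (atom (rel R ts)) hp s =
      mk⇔ (subst (relI R) (evals-renT hp s ts)) (subst (relI R) (sym (evals-renT hp s ts)))
    sat-renF tt         hp s = mk⇔ id id
    sat-renF ff         hp s = mk⇔ id id
    sat-renF (neg a)    hp s = ¬-cong-⇔ (sat-renF a hp s)
    sat-renF (and a b)  hp s = sat-renF a hp s ×-⇔ sat-renF b hp s
    sat-renF (or a b)   hp s = sat-renF a hp s ⊎-⇔ sat-renF b hp s
    sat-renF (imp a b)  hp s = →-cong-⇔ (sat-renF a hp s) (sat-renF b hp s)
    sat-renF (allT x a) hp s = Π-⇔ λ d → sat-ext a hp (update-renamed s x d) ⇔-∘ sat-renF a hp _
    sat-renF (exT x a)  hp s = Σ-⇔ λ d → sat-ext a hp (update-renamed s x d) ⇔-∘ sat-renF a hp _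
    sat-renF (allP p a) hp s = Π-⇔ λ d → sat-renF a _ s
    sat-renF (exP p a)  hp s = Σ-⇔ λ d → sat-renF a _ s

  mutual
    eval-copy : ∀ (hp : ℕ → D) s ρ (t : Term ⊥) → evalT M hp s (mapT ⊥-elim ρ t) ≡ evalT M ⊥-elim (s ∘ ρ) t
    eval-copy hp s ρ (par ())
    eval-copy hp s ρ (var x)   = refl
    eval-copy hp s ρ (fn f ts) = cong (funI f) (evals-copy hp s ρ ts)

    evals-copy : ∀ (hp : ℕ → D) s ρ {n} (ts : Vec (Term ⊥) n) →
                 evalTs M hp s (mapTs ⊥-elim ρ ts) ≡ evalTs M ⊥-elim (s ∘ ρ) ts
    evals-copy hp s ρ Vec.[]       = refl
    evals-copy hp s ρ (t Vec.∷ ts) = cong₂ Vec._∷_ (eval-copy hp s ρ t) (evals-copy hp s ρ ts)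

  sat-eqs : ∀ ts ρ ρ′ hp s → sat M (eqs (copy ρ ts) (copy ρ′ ts)) hp s ⇔ (evs M ts (s ∘ ρ) ≡ evs M ts (s ∘ ρ′))
  sat-eqs []       ρ ρ′ hp s = mk⇔ (λ _ → refl) (λ _ → tt)
  sat-eqs (t ∷ ts) ρ ρ′ hp s =
    mk⇔ (λ (e , es) → cong₂ _∷_ (trans (sym (eval-copy hp s ρ t)) (trans e (eval-copy hp s ρ′ t)))
                                (to (sat-eqs ts ρ ρ′ hp s) es))
        (λ e → trans (eval-copy hp s ρ t) (trans (∷-injectiveˡ e) (sym (eval-copy hp s ρ′ t))) ,
               from (sat-eqs ts ρ ρ′ hp s) (∷-injectiveʳ e))

  allTs-intro : ∀ xs a hp → (∀ s → sat M a hp s) → ∀ s → sat M (allTs xs a) hp s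
  allTs-intro []       a hp valid s   = valid s
  allTs-intro (x ∷ xs) a hp valid s d = allTs-intro xs a hp valid _

  exTs-intro : ∀ xs a hp s s′ → (∀ y → y ∉ xs → s′ y ≡ s y) → sat M a hp s′ → sat M (exTs xs a) hp s
  exTs-intro []       a hp s s′ same x = to (sat-ext a hp (λ y → same y λ ())) x
  exTs-intro (x ∷ xs) a hp s s′ same y = s′ x , exTs-intro xs a hp _ s′ same′ y
    where
      same′ : ∀ z → z ∉ xs → s′ z ≡ update M s x (s′ x) z
      same′ z z∉xs with z ≟ x
      ... | yes refl = refl
      ... | no z≢x   = same z λ { (here e) → z≢x e ; (there i) → z∉xs i }

  updates : (ℕ → D) → (ℕ → ℕ) → List ℕ → (ℕ → D) → ℕ → D
  updates s ρ []       t = s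
  updates s ρ (x ∷ xs) t = update M (updates s ρ xs t) (ρ x) (t x)

  updates-outside : ∀ s ρ xs t y → y ∉ map ρ xs → updates s ρ xs t y ≡ s y
  updates-outside s ρ []       t y y∉ = refl
  updates-outside s ρ (x ∷ xs) t y y∉ =
    trans (update-miss _ _ (y∉ ∘ here)) (updates-outside s ρ xs t y (y∉ ∘ there))

  updates-inside : ∀ s ρ → Injective _≡_ _≡_ ρ → ∀ xs t x → x ∈ xs → updates s ρ xs t (ρ x) ≡ t x
  updates-inside s ρ ρ-inj (x₀ ∷ xs) t x i with ρ x ≟ ρ x₀ | i
  ... | yes e         | _         = cong t (sym (ρ-inj e))
  ... | no ρx≢ρx₀     | here refl = ⊥-elim (ρx≢ρx₀ refl)
  ... | no _          | there i′  = updates-inside s ρ ρ-inj xs t x i′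

  ⊨₁-allTs : ∀ {h} xs a → ⊨₁ M h a → ⊨₁ M h (allTs xs a)
  ⊨₁-allTs {h} xs a (cov , valid) =
    (λ q i → cov q (subst (q ∈_) (fpP-allTs xs a) i)) , allTs-intro xs a (val h) valid

  ⊨Γ-single : ∀ {h a} → ⊨₁ M h a → ⊨Γ M h (a ∷ [])
  ⊨Γ-single m _ (here refl) = m

  ⊨Γ-++ : ∀ {h} Γ₁ {Γ₂} → ⊨Γ M h Γ₁ → ⊨Γ M h Γ₂ → ⊨Γ M h (Γ₁ ++ Γ₂)
  ⊨Γ-++ Γ₁ m₁ m₂ a i = [ m₁ a , m₂ a ]′ (∈-++⁻ Γ₁ i)

  ⊨Γ⇒⊨⋀ : ∀ {h} Γ → ⊨Γ M h Γ → ⊨₁ M h (bigAnd Γ)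
  ⊨Γ⇒⊨⋀ []      m = (λ q ()) , (λ s → tt)
  ⊨Γ⇒⊨⋀ (a ∷ Γ) m =
    let (cov-a , valid-a) = m a (here refl)
        (cov-Γ , valid-Γ) = ⊨Γ⇒⊨⋀ Γ (λ b i → m b (there i))
    in (λ q i → [ cov-a q , cov-Γ q ]′ (∈-++⁻ (fpP a) i)) , (λ s → valid-a s , valid-Γ s)

  ⊨⋀⇒⊨Γ : ∀ {h} Γ → ⊨₁ M h (bigAnd Γ) → ⊨Γ M h Γ
  ⊨⋀⇒⊨Γ (a ∷ Γ) (cov , valid) .a (here refl) = (λ q i → cov q (∈-++⁺ˡ i)) , (proj₁ ∘ valid)
  ⊨⋀⇒⊨Γ (a ∷ Γ) (cov , valid) b  (there i)   =
    ⊨⋀⇒⊨Γ Γ ((λ q j → cov q (∈-++⁺ʳ (fpP a) j)) , (proj₂ ∘ valid)) b i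

  litAx-valid : ∀ {h} γ l → Sem M (lit l) γ h → ⊨₁ M h (closeT (imp γ (litF l)))
  litAx-valid {h} γ l (covγ , valid) = ⊨₁-allTs (fvT (imp γ (litF l))) (imp γ (litF l)) (cov , valid)
    where
      cov : Covers M h (imp γ (litF l))
      cov q i with ∈-++⁻ (fpP γ) i
      ... | inj₁ i′ = covγ q i′
      ... | inj₂ i′ with () ← subst (q ∈_) (fpP-litF l) i′

  -- The side condition of PS-ind is valid under h: given copies s∘ρ₁ and
  -- s∘ρ₂ of two team members agreeing on t̄₁, the mixing member s″ given by
  -- the semantics of the atom is written into the third copy ρ₃.
  indAx-valid : ∀ {h} γ t₁ t₂ t₃ → Sem M (ind t₁ t₂ t₃) γ h → ⊨₁ M h (indAx γ t₁ t₂ t₃)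
  indAx-valid {h} γ t₁ t₂ t₃ (covγ , mix) =
    ⊨₁-allTs (map ρ₁ vs ++ map ρ₂ vs) (indBody γ t₁ t₂ t₃)
      ((λ q i → covγ q (fpP-indBody γ t₁ t₂ t₃ i)) , body)
    where
      vs : List ℕ
      vs = indVars γ t₁ t₂ t₃

      module R₁ = Renaming ρ₁ ρ₁-injective
      module R₂ = Renaming ρ₂ ρ₂-injective
      module R₃ = Renaming ρ₃ ρ₃-injective

      body : ∀ s → sat M (indBody γ t₁ t₂ t₃) (val h) s
      body s (γ₁ , γ₂ , e₁)
        with mix (s ∘ ρ₁) (s ∘ ρ₂) (to (R₁.sat-renF γ (val h) s) γ₁)
                 (to (R₂.sat-renF γ (val h) s) γ₂) (to (sat-eqs t₁ ρ₁ ρ₂ (val h) s) e₁)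
      ... | s″ , γ″ , agree₁₂ , agree₁₃ =
        exTs-intro (map ρ₃ vs) (indConcl γ t₁ t₂ t₃) (val h) s s₃ (updates-outside s ρ₃ vs s″)
          ( from (R₃.sat-renF γ (val h) s₃)
              (sat-coincidence γ _ _ s″ _ (λ _ _ → refl) (agree-⊆ (xs⊆xs++ys _ _) copied) γ″)
          , from (sat-eqs (t₁ ++ t₂) ρ₃ ρ₁ (val h) s₃)
              (same-values (t₁ ++ t₂) ρ₁ (indVars-⊇₁₂ γ t₁ t₂ t₃) ρ₁≢ρ₃ agree₁₂)
          , from (sat-eqs (t₁ ++ t₃) ρ₃ ρ₂ (val h) s₃)
              (same-values (t₁ ++ t₃) ρ₂ (indVars-⊇₁₃ γ t₁ t₂ t₃) ρ₂≢ρ₃ agree₁₃) )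
        where
          s₃ : ℕ → D
          s₃ = updates s ρ₃ vs s″

          copied : Agree vs s″ (s₃ ∘ ρ₃)
          copied v i = sym (updates-inside s ρ₃ ρ₃-injective vs s″ v i)

          -- the ρ₃-copy of s₃ carries s″, while a disjoint copy ρ still carries s
          same-values : ∀ ts ρ → concatFv ts ⊆ vs → (∀ v w → ρ v ≢ ρ₃ w) →
                        evs M ts s″ ≡ evs M ts (s ∘ ρ) → evs M ts (s₃ ∘ ρ₃) ≡ evs M ts (s₃ ∘ ρ)
          same-values ts ρ ts⊆vs ρ≢ρ₃ e =
            trans (sym (evs-coincidence ts s″ (s₃ ∘ ρ₃) (agree-⊆ ts⊆vs copied)))
                  (trans e (evs-coincidence ts (s ∘ ρ) (s₃ ∘ ρ) unchanged))
            where
              unchanged : Agree (concatFv ts) (s ∘ ρ) (s₃ ∘ ρ)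
              unchanged v _ = sym (updates-outside s ρ₃ vs s″ (ρ v)
                (λ i → let (w , _ , e′) = ∈-map⁻ ρ₃ i in ρ≢ρ₃ v w e′))

  module ParameterElimination (h h′ : PAssign M) (h⊑h′ : _⊑_ M h h′) (γ : Form) (covγ : Covers M h γ) where

    Valid : List ℕ → Form → Set
    Valid ps a = (∀ q → q ∈ fpP a → q ∈ dom h ⊎ q ∈ ps) ×
                 (∀ hp → Agree (dom h) hp (val h) → Agree ps hp (val h′) → ∀ s → sat M a hp s)

    valid-start : ∀ a → ⊨₁ M h′ a → Valid (dom h′) a
    valid-start a (cov , valid) =
      (λ q i → inj₂ (cov q i)) ,
      (λ hp _ agree′ s → sat-coincidence a (val h′) hp s s
                           (λ q i → sym (agree′ q (cov q i))) (λ _ _ → refl) (valid s))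

    -- a parameter already in dom h needs no quantifier
    valid-drop : ∀ {p ps} a → p ∈ dom h → Valid (p ∷ ps) a → Valid ps a
    valid-drop {p} a p∈h (cov , valid) =
      (λ q i → [ inj₁ , (λ { (here refl) → inj₁ p∈h ; (there j) → inj₂ j }) ]′ (cov q i)) ,
      (λ hp agree agree′ → valid hp agree λ
         { q (here refl) → trans (agree q p∈h) (proj₂ (h⊑h′ q p∈h)) ; q (there j) → agree′ q j })

    -- a parameter outside dom h is quantified existentially, witnessed by h′
    valid-exP : ∀ {p ps} a → p ∉ dom h → Valid (p ∷ ps) a → Valid ps (exP p a)
    valid-exP {p} {ps} a p∉h (cov , valid) =
      cov′ ,
      (λ hp agree agree′ s → val h′ p ,
         valid _ (agree-update-fresh _ p∉h agree) (agree-update-cons p agree′) s)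
      where
        cov′ : ∀ q → q ∈ fpP (exP p a) → q ∈ dom h ⊎ q ∈ ps
        cov′ q i with ∈-filter⁻ (λ z → ¬? (z ≟ p)) {xs = fpP a} i
        ... | j , q≢p with cov q j
        ...   | inj₁ q∈h        = inj₁ q∈h
        ...   | inj₂ (here q≡p) = ⊥-elim (q≢p q≡p)
        ...   | inj₂ (there k)  = inj₂ k

    -- ps-depar produces the singleton context of the quantified formula
    valid-single : ∀ {ps} a → Valid ps a → Valid ps (bigAnd (a ∷ []))
    valid-single a (cov , valid) =
      (λ q i → [ cov q , (λ ()) ]′ (∈-++⁻ (fpP a) i)) , (λ hp agree agree′ s → valid hp agree agree′ s , tt)

    valid-end : ∀ a → Valid [] a → ⊨₁ M h a
    valid-end a (cov , valid) =
      (λ q i → [ id , (λ ()) ]′ (cov q i)) , valid (val h) (λ _ _ → refl) (λ _ ())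

    eliminate : ∀ {φ} ps Γ → Prov Γ γ φ → Valid ps (bigAnd Γ) →
                Σ (List Form) λ Γ′ → Prov Γ′ γ φ × ⊨Γ M h Γ′
    eliminate []       Γ der v = Γ , der , ⊨⋀⇒⊨Γ Γ (valid-end (bigAnd Γ) v)
    eliminate (p ∷ ps) Γ der v with p ∈? dom h
    ... | yes p∈h = eliminate ps Γ der (valid-drop (bigAnd Γ) p∈h v)
    ... | no p∉h  = eliminate ps (exP p (bigAnd Γ) ∷ [])
                      (ps-depar p (p∉h ∘ covγ p) der)
                      (valid-single (exP p (bigAnd Γ)) (valid-exP (bigAnd Γ) p∉h v))

    lift : ∀ {φ Γ} → Prov Γ γ φ → ⊨Γ M h′ Γ → Σ (List Form) λ Γ′ → Prov Γ′ γ φ × ⊨Γ M h Γ′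
    lift {Γ = Γ} der m = eliminate (dom h′) Γ der (valid-start (bigAnd Γ) (⊨Γ⇒⊨⋀ Γ m))

  open ParameterElimination using (lift)

  completeness : ∀ φ γ h → Sem M φ γ h → Σ (List Form) λ Γ → Prov Γ γ φ × ⊨Γ M h Γ
  completeness (lit l) γ h sem =
    _ , ps-lit γ l , ⊨Γ-single (litAx-valid γ l sem)
  completeness (ind t₁ t₂ t₃) γ h sem =
    _ , ps-ind γ t₁ t₂ t₃ , ⊨Γ-single (indAx-valid γ t₁ t₂ t₃ sem)
  completeness (and φ ψ) γ h (_ , semφ , semψ) =
    let (Γ₁ , der₁ , m₁) = completeness φ γ h semφ
        (Γ₂ , der₂ , m₂) = completeness ψ γ h semψ
    in Γ₁ ++ Γ₂ , ps-and der₁ der₂ , ⊨Γ-++ Γ₁ m₁ m₂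
  completeness (or φ ψ) γ h (covγ , h′ , h⊑h′ , γ₁ , γ₂ , semφ , semψ , split) =
    let (Γ₁ , der₁ , m₁) = completeness φ γ₁ h′ semφ
        (Γ₂ , der₂ , m₂) = completeness ψ γ₂ h′ semψ
    in lift h h′ h⊑h′ γ covγ (ps-or γ der₁ der₂) (⊨Γ-++ Γ₁ m₁ (⊨Γ-++ Γ₂ m₂ (⊨Γ-single split)))
  completeness (ex x ψ) γ h (covγ , h′ , h⊑h′ , γ′ , semψ , ex-equiv) =
    let (Γ₁ , der₁ , m₁) = completeness ψ γ′ h′ semψ
    in lift h h′ h⊑h′ γ covγ (ps-ex γ x der₁) (⊨Γ-++ Γ₁ m₁ (⊨Γ-single ex-equiv))
  completeness (all x ψ) γ h (covγ , h′ , h⊑h′ , γ′ , semψ , all-equiv) =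
    let (Γ₁ , der₁ , m₁) = completeness ψ γ′ h′ semψ
    in lift h h′ h⊑h′ γ covγ (ps-all γ x der₁) (⊨Γ-++ Γ₁ m₁ (⊨Γ-single all-equiv))

mainTheorem20 : (S : Signature) → let open FO S in
    (M : Structure) (h : PAssign M) (γ : Form) (φ : IL) →
    Sem M φ γ h →
    Σ (List Form) λ Γ → Prov Γ γ φ × ⊨Γ M h Γ
mainTheorem20 S M h γ φ = Completeness.completeness S M φ γ h
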